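{- For every admissible neighborly partition $\lambda$, every connected component of $G'_\lambda$ is of one of the following six types, described by the labels of its vertices (with $a$ a positive integer): a single edge joining two vertices labelled $a,a$; a single edge joining vertices labelled $a,a+1$; a path $a,a,a+1$; a path $a,a+1,a+1$; a path $a,a+1,a+2$; or a tree with four vertices labelled $a,a+1,a+1,a+2$ in which a vertex labelled $a+1$ is adjacent to the other three.
   Context: Partitions are written with parts in increasing order. A partition $\lambda$ is neighborly if every value occurs as a part at most twice and for every part $\lambda_i$ there is a part $\lambda_j$ with $j\ne i$ and $|\lambda_i-\lambda_j|\le 1$. Write $\lambda=(\mu_1,\mu_2)$ where $\mu_1$ is the set of distinct part values and $\mu_2\subseteq\mu_1$ the set of values occurring twice. The graph $G_\lambda$ has one vertex $v$ (labelled $v$) for each $v\in\mu_1$ and one additional vertex $v'$ (also labelled $v$) for each $v\in\mu_2$; its edges are the backbone edges $\{v,v+1\}$ whenever $v,v+1\in\mu_1$, and the hanging edges $\{v,v'\}$ for $v\in\mu_2$. Chains: each connected component $c$ of $G_\lambda$ has backbone vertices forming a maximal run $\{k,\dots,n\}$ of consecutive integers in $\mu_1$; let $a_1<\dots<a_s$ be the elements of $\mu_2$ in it. If $s=0$, $c$ has the single chain $k,k+1,\dots,n$. If $s\ge1$, $c$ has the chains (paths, edges ordered left to right) $k,\dots,a_1,a_1'$; $a_{i}',a_{i},a_i+1,\dots,a_{i+1},a_{i+1}'$ for $1\le i<s$; and $a_s',a_s,a_s+1,\dots,n$. $\lambda$ is admissible if no chain has a number of edges divisible by $3$. $G'_\lambda$: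 for admissible $\lambda$, from each chain with edges $e_1,\dots,e_m$ (left to right) delete: $e_3,e_6,\dots,e_{m-2}$ if $m\equiv 2\pmod 3$; $e_3,e_6,\dots,e_{3p}$ and $e_{3p+2},e_{3p+5},\dots,e_{6p-1}$ if $m=6p+1$; $e_3,e_6,\dots,e_{3p}$ and $e_{3p+2},e_{3p+5},\dots,e_{6p+2}$ if $m=6p+4$. $G'_\lambda$ is $G_\lambda$ with all these edges removed (same vertices and labels). -}

module Defs where

open import Data.Nat using (ℕ; zero; suc; _+_; _*_; _∸_; _≤_; _<_; ∣_-_∣)
open import Data.Nat.Properties using (_≟_)
open import Data.Nat.Divisibility using (_∣_)
open import Data.Bool using (Bool; true; false; T)
open import Data.Fin using (Fin; zero; suc)
open import Data.List using (List; length; filter; lookup)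
open import Data.List.Membership.Propositional using (_∈_; _∉_)
open import Data.List.Relation.Unary.All using (All)
open import Data.List.Relation.Unary.Linked using (Linked)
open import Data.Product using (Σ; ∃; _×_; _,_; proj₁)
open import Data.Sum using (_⊎_)
open import Function.Definitions using (Injective)
open import Function.Bundles using (_⇔_)
open import Relation.Nullary using (¬_)
open import Relation.Binary.PropositionalEquality using (_≡_; _≢_)
open import Relation.Binary.Construct.Closure.ReflexiveTransitive using (Star)

IsPartition : List ℕ → Set
IsPartition p = All (λ x → 1 ≤ x) p × Linked _≤_ p

mult : ℕ → List ℕ → ℕ
mult v p = length (filter (v ≟_) p)

InMu1 : List ℕ → ℕ → Set
InMu1 p v = v ∈ p

InMu2 : List ℕ → ℕ → Set
InMu2 p v = mult v p ≡ 2

Neighborly : List ℕ → Set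
Neighborly p =
  (∀ v → mult v p ≤ 2) ×
  (∀ (i : Fin (length p)) → ∃ λ (j : Fin (length p)) →
      j ≢ i × ∣ lookup p i - lookup p j ∣ ≤ 1)

-- The graph G_λ.  A vertex is a pair (v , b): (v , false) is the backbone
-- vertex v (for v ∈ μ₁), (v , true) is the extra vertex v' (for v ∈ μ₂).
-- Both are labelled v.

Vertex : Set
Vertex = ℕ × Bool

label : Vertex → ℕ
label = proj₁

IsVertex : List ℕ → Vertex → Set
IsVertex p (v , false) = InMu1 p v
IsVertex p (v , true)  = InMu2 p v

data EdgeG (p : List ℕ) : Vertex → Vertex → Set where
  backbone : ∀ v → InMu1 p v → InMu1 p (suc v) → EdgeG p (v , false) (suc v , false)
  hanging  : ∀ v → InMu2 p v → EdgeG p (v , false) (v , true)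

AdjG : List ℕ → Vertex → Vertex → Set
AdjG p x y = EdgeG p x y ⊎ EdgeG p y x

-- A chain is described by (lh , l , r , rh): it is the path
--   [l' ,] l , l+1 , … , r [, r']
-- where l' is present iff lh = true and r' is present iff rh = true.
-- A component with backbone run {k,…,n} and μ₂ ∩ {k,…,n} = {a₁<…<a_s}
-- has the chains listed by the constructors below.

RunIn : List ℕ → ℕ → ℕ → Set
RunIn p l r = ∀ v → l ≤ v → v ≤ r → InMu1 p v

RunStart : List ℕ → ℕ → Set
RunStart p k = ∀ j → suc j ≡ k → ¬ InMu1 p j

RunEnd : List ℕ → ℕ → Set
RunEnd p n = ¬ InMu1 p (suc n)

data IsChain (p : List ℕ) : Bool → ℕ → ℕ → Bool → Set where
  -- s = 0 : the chain k , … , n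
  noDouble : ∀ k n → k ≤ n → RunIn p k n → RunStart p k → RunEnd p n →
             (∀ v → k ≤ v → v ≤ n → ¬ InMu2 p v) →
             IsChain p false k n false
  -- s ≥ 1 : the chain k , … , a₁ , a₁'
  first    : ∀ k a → k ≤ a → RunIn p k a → RunStart p k → InMu2 p a →
             (∀ v → k ≤ v → v < a → ¬ InMu2 p v) →
             IsChain p false k a true
  -- s ≥ 2 : the chain a_i' , a_i , … , a_{i+1} , a_{i+1}'
  middle   : ∀ a b → a < b → RunIn p a b → InMu2 p a → InMu2 p b →
             (∀ v → a < v → v < b → ¬ InMu2 p v) →
             IsChain p true a b true
  -- s ≥ 1 : the chain a_s' , a_s , … , n
  last     : ∀ a n → a ≤ n → RunIn p a n → InMu2 p a → RunEnd p n →
             (∀ v → a < v → v ≤ n → ¬ InMu2 p v) →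
             IsChain p true a n false

b2n : Bool → ℕ
b2n false = 0
b2n true  = 1

chainLength : Bool → ℕ → ℕ → Bool → ℕ
chainLength lh l r rh = b2n lh + (r ∸ l) + b2n rh

-- ChainEdge lh l r rh j x y : the j-th edge (j ≥ 1, counted from the left)
-- of the chain (lh , l , r , rh) joins x (left) and y (right).
data ChainEdge : Bool → ℕ → ℕ → Bool → ℕ → Vertex → Vertex → Set where
  hangL : ∀ l r rh → ChainEdge true l r rh 1 (l , true) (l , false)
  back  : ∀ lh l r rh i → i < r ∸ l →
          ChainEdge lh l r rh (suc i + b2n lh) (l + i , false) (suc (l + i) , false)
  hangR : ∀ lh l r → ChainEdge lh l r true (b2n lh + (r ∸ l) + 1) (r , false) (r , true)

-- DeletedPos m j : edge e_j is deleted from a chain with m edges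
data DeletedPos : ℕ → ℕ → Set where
  -- m ≡ 2 (mod 3) : e₃ , e₆ , … , e_{m-2}
  mod2   : ∀ q t → 1 ≤ t → 3 * t + 2 ≤ 3 * q + 2 →
           DeletedPos (3 * q + 2) (3 * t)
  -- m = 6p+1 : e₃ , … , e_{3p}
  m1a    : ∀ p t → 1 ≤ t → t ≤ p → DeletedPos (6 * p + 1) (3 * t)
  -- m = 6p+1 : e_{3p+2} , e_{3p+5} , … , e_{6p-1}
  m1b    : ∀ p t → 3 * p + 2 + 3 * t + 1 ≤ 6 * p →
           DeletedPos (6 * p + 1) (3 * p + 2 + 3 * t)
  -- m = 6p+4 : e₃ , … , e_{3p}
  m4a    : ∀ p t → 1 ≤ t → t ≤ p → DeletedPos (6 * p + 4) (3 * t)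
  -- m = 6p+4 : e_{3p+2} , e_{3p+5} , … , e_{6p+2}
  m4b    : ∀ p t → 3 * p + 2 + 3 * t ≤ 6 * p + 2 →
           DeletedPos (6 * p + 4) (3 * p + 2 + 3 * t)

Admissible : List ℕ → Set
Admissible p = ∀ lh l r rh → IsChain p lh l r rh → ¬ (3 ∣ chainLength lh l r rh)

Deleted : List ℕ → Vertex → Vertex → Set
Deleted p x y = Σ Bool λ lh → Σ ℕ λ l → Σ ℕ λ r → Σ Bool λ rh → Σ ℕ λ j →
  IsChain p lh l r rh × ChainEdge lh l r rh j x y ×
  DeletedPos (chainLength lh l r rh) j

Adj' : List ℕ → Vertex → Vertex → Set
Adj' p x y = AdjG p x y × ¬ Deleted p x y × ¬ Deleted p y x

-- A pattern is a small graph on Fin k with label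
-- offsets; the component of x in G'_λ realises a pattern if there is an
-- injective map f from the pattern vertices onto the component, with
-- labels a + offset and edges exactly the pattern edges.

record Pattern : Set where
  field
    size   : ℕ
    offset : Fin size → ℕ
    edge   : Fin size → Fin size → Bool

open Pattern

Realizes : List ℕ → Vertex → Pattern → Set
Realizes p x P =
  Σ ℕ λ a → 1 ≤ a × Σ (Fin (size P) → Vertex) λ f →
    Injective _≡_ _≡_ f ×
    (∀ y → Star (Adj' p) x y ⇔ (∃ λ i → f i ≡ y)) ×
    (∀ i j → Adj' p (f i) (f j) ⇔ T (edge P i j)) ×
    (∀ i → label (f i) ≡ a + offset P i)

edge2 : Fin 2 → Fin 2 → Bool
edge2 zero (suc zero) = true
edge2 (suc zero) zero = true
edge2 _ _ = false

path3 : Fin 3 → Fin 3 → Bool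
path3 zero (suc zero) = true
path3 (suc zero) zero = true
path3 (suc zero) (suc (suc zero)) = true
path3 (suc (suc zero)) (suc zero) = true
path3 _ _ = false

star4 : Fin 4 → Fin 4 → Bool
star4 (suc zero) zero = true
star4 (suc zero) (suc (suc zero)) = true
star4 (suc zero) (suc (suc (suc zero))) = true
star4 zero (suc zero) = true
star4 (suc (suc zero)) (suc zero) = true
star4 (suc (suc (suc zero))) (suc zero) = true
star4 _ _ = false

off-aa : Fin 2 → ℕ
off-aa _ = 0

off-ab : Fin 2 → ℕ
off-ab zero = 0
off-ab (suc _) = 1

off-aab : Fin 3 → ℕ
off-aab zero = 0
off-aab (suc zero) = 0
off-aab (suc (suc _)) = 1

off-abb : Fin 3 → ℕ
off-abb zero = 0
off-abb (suc _) = 1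

off-abc : Fin 3 → ℕ
off-abc zero = 0
off-abc (suc zero) = 1
off-abc (suc (suc _)) = 2

off-abbc : Fin 4 → ℕ
off-abbc zero = 0
off-abbc (suc zero) = 1
off-abbc (suc (suc zero)) = 1
off-abbc (suc (suc (suc _))) = 2

typeAA : Pattern
typeAA = record { size = 2 ; offset = off-aa ; edge = edge2 }

typeAB : Pattern
typeAB = record { size = 2 ; offset = off-ab ; edge = edge2 }

typeAAB : Pattern
typeAAB = record { size = 3 ; offset = off-aab ; edge = path3 }

typeABB : Pattern
typeABB = record { size = 3 ; offset = off-abb ; edge = path3 }

typeABC : Pattern
typeABC = record { size = 3 ; offset = off-abc ; edge = path3 }

typeABBC : Pattern
typeABBC = record { size = 4 ; offset = off-abbc ; edge = star4 }

OfSixTypes : List ℕ → Vertex → Set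
OfSixTypes p x =
  Realizes p x typeAA ⊎ Realizes p x typeAB ⊎ Realizes p x typeAAB ⊎
  Realizes p x typeABB ⊎ Realizes p x typeABC ⊎ Realizes p x typeABBC

-- Every chain has m ≢ 0 (mod 3) edges, so m is 3s+2, 6s+1 or 6s+4, and its deleted edges are
-- e₃, e₆, …, e_{3s} followed by e_{3s+2}, e_{3s+5}, …, e_{m−2}. Hence the first and the last edge
-- of a chain are kept, no two consecutive edges are deleted, and among any three consecutive
-- edges one is deleted. Consequently in G'_λ every hanging edge survives, every vertex keeps an
-- edge (an isolated vertex of G_λ would be a chain with 0 edges), two doubled values are never
-- adjacent (a chain with 3 edges), and no path with three edges survives. Walking left from any
-- vertex to the leftmost backbone vertex l of its component, the component is l alone with l′,
-- or the backbone path l, l+1 or l, l+1, l+2 with hanging vertices only where no three-edge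
-- path appears — exactly the six types.
module Submission where

open import Defs
open import Data.Bool using (Bool; true; false; T)
open import Data.Empty using (⊥; ⊥-elim)
open import Data.Fin using (Fin)
open import Data.Fin.Patterns using (0F; 1F; 2F; 3F; 4F; 5F)
open import Data.List using (List; []; _∷_; length)
open import Data.List.Extrema.Nat using (max; xs≤max)
open import Data.List.Membership.Propositional using (_∈_)
open import Data.List.Properties using (filter-reject)
open import Data.List.Relation.Unary.All as All using (All)
open import Data.List.Relation.Unary.Any using (here; there)
open import Data.Nat
open import Data.Nat.DivMod
open import Data.Nat.Divisibility using (_∣_; divides)
open import Data.Nat.Properties
open import Data.Nat.Tactic.RingSolver using (solve-∀; solve)
open import Data.List.Membership.DecPropositional _≟_ using (_∈?_)
open import Data.Product using (∃; _×_; _,_; proj₁; proj₂)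
open import Data.Sum using (_⊎_; inj₁; inj₂; [_,_]′)
import Data.Sum
open import Function using (_∘_)
open import Function.Bundles using (_⇔_; mk⇔)
open import Function.Definitions using (Injective)
open import Relation.Binary.Construct.Closure.ReflexiveTransitive using (Star; ε; _◅_; _◅◅_; reverse; return)
open import Relation.Binary.Definitions using (tri<; tri≈; tri>)
open import Relation.Binary.PropositionalEquality
open import Relation.Nullary using (¬_; Dec; yes; no; contradiction)
open import Relation.Nullary.Decidable using (True; toWitness; _×-dec_; _⊎-dec_; map′)

remainder-unique : ∀ k a b {r s} .{{_ : NonZero k}} {r<k : True (r <? k)} {s<k : True (s <? k)} →
                   k * a + r ≡ k * b + s → r ≡ s
remainder-unique k a b {r} {s} {r<k} {s<k} eq = begin
  r                ≡⟨ m<n⇒m%n≡m (toWitness r<k) ⟨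
  r % k            ≡⟨ [m+kn]%n≡m%n r a k ⟨
  (r + a * k) % k  ≡⟨ cong (_% k) (trans (swap a r) (trans eq (sym (swap b s)))) ⟩
  (s + b * k) % k  ≡⟨ [m+kn]%n≡m%n s b k ⟩
  s % k            ≡⟨ m<n⇒m%n≡m (toWitness s<k) ⟩
  s                ∎
  where
  open ≡-Reasoning
  swap : ∀ x y → y + x * k ≡ k * x + y
  swap x y = trans (+-comm y (x * k)) (cong (_+ y) (*-comm x k))

quotient-unique : ∀ k a b {r s} .{{_ : NonZero k}} {r<k : True (r <? k)} {s<k : True (s <? k)} →
                  k * a + r ≡ k * b + s → a ≡ b
quotient-unique k a b {r} {r<k = r<k} {s<k} eq =
  *-cancelˡ-≡ a b k (+-cancelʳ-≡ r (k * a) (k * b)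
    (trans eq (cong (k * b +_) (sym (remainder-unique k a b {r<k = r<k} {s<k} eq)))))

residues-differ : ∀ {n} a b {r s} {r<3 : True (r <? 3)} {s<3 : True (s <? 3)} → r ≢ s →
                  n ≡ 3 * a + r → n ≡ 3 * b + s → ⊥
residues-differ a b {r<3 = r<3} {s<3} r≢s e e′ =
  r≢s (remainder-unique 3 a b {r<k = r<3} {s<3} (trans (sym e) e′))

3*m≤3*n+2⇒m≤n : ∀ m n → 3 * m ≤ 3 * n + 2 → m ≤ n
3*m≤3*n+2⇒m≤n m n le with m ≤? n
... | yes m≤n = m≤n
... | no m≰n  = contradiction (≤-trans (*-monoʳ-≤ 3 (≰⇒> m≰n)) le) (<⇒≱ (≤-reflexive 1+[3n+2]≡3[1+n]))
  where
  1+[3n+2]≡3[1+n] : suc (3 * n + 2) ≡ 3 * suc n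
  1+[3n+2]≡3[1+n] = solve (n ∷ [])

3u+2≤3n+1⇒3u+4≤3n+1 : ∀ u n → 3 * u + 2 ≤ 3 * n + 1 → 3 * u + 2 + 2 ≤ 3 * n + 1
3u+2≤3n+1⇒3u+4≤3n+1 u n le = begin
  3 * u + 2 + 2  ≡⟨ solve (u ∷ []) ⟩
  3 * suc u + 1  ≤⟨ +-monoˡ-≤ 1 (*-monoʳ-≤ 3 1+u≤n) ⟩
  3 * n + 1      ∎
  where
  open ≤-Reasoning
  1+u≤n : suc u ≤ n
  1+u≤n = 3*m≤3*n+2⇒m≤n (suc u) n (begin
    3 * suc u        ≡⟨ solve (u ∷ []) ⟩
    suc (3 * u + 2)  ≤⟨ s≤s le ⟩
    suc (3 * n + 1)  ≡⟨ solve (n ∷ []) ⟩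
    3 * n + 2        ∎)

6s+1≡3[2s]+1 : ∀ s → 6 * s + 1 ≡ 3 * (2 * s) + 1
6s+1≡3[2s]+1 = solve-∀

6s+4≡3[2s+1]+1 : ∀ s → 6 * s + 4 ≡ 3 * (2 * s + 1) + 1
6s+4≡3[2s+1]+1 = solve-∀

3p+2+3t≡3[p+t]+2 : ∀ p t → 3 * p + 2 + 3 * t ≡ 3 * (p + t) + 2
3p+2+3t≡3[p+t]+2 = solve-∀

j≡3t⇒1+j≡3t+1 : ∀ {j} t → j ≡ 3 * t → suc j ≡ 3 * t + 1
j≡3t⇒1+j≡3t+1 t j≡3t = trans (cong suc j≡3t) (+-comm 1 (3 * t))

j≡3u+2⇒1+j≡3[1+u] : ∀ {j} u → j ≡ 3 * u + 2 → suc j ≡ 3 * suc u + 0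
j≡3u+2⇒1+j≡3[1+u] u j≡3u+2 = trans (cong suc j≡3u+2) (solve (u ∷ []))

-- Deleted positions of a chain

data LengthForm (s m : ℕ) : Set where
  ≡3s+2 : m ≡ 3 * s + 2 → LengthForm s m
  ≡6s+1 : m ≡ 6 * s + 1 → LengthForm s m
  ≡6s+4 : m ≡ 6 * s + 4 → LengthForm s m

lengthForm : ∀ {m} → ¬ 3 ∣ m → ∃ λ s → LengthForm s m
lengthForm {m} 3∤m with m divMod 6
... | result s 0F e = contradiction (divides (2 * s) (trans e (solve (s ∷ [])))) 3∤m
... | result s 1F e = s , ≡6s+1 (trans e (solve (s ∷ [])))
... | result s 2F e = 2 * s , ≡3s+2 (trans e (solve (s ∷ [])))
... | result s 3F e = contradiction (divides (2 * s + 1) (trans e (solve (s ∷ [])))) 3∤m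
... | result s 4F e = s , ≡6s+4 (trans e (solve (s ∷ [])))
... | result s 5F e = 2 * s + 1 , ≡3s+2 (trans e (solve (s ∷ [])))

lengthForm-unique : ∀ {s s′ m} → LengthForm s m → LengthForm s′ m → s ≡ s′
lengthForm-unique {s} {s′} (≡3s+2 e) (≡3s+2 e′) = quotient-unique 3 s s′ (trans (sym e) e′)
lengthForm-unique {s} {s′} (≡6s+1 e) (≡6s+1 e′) = quotient-unique 6 s s′ (trans (sym e) e′)
lengthForm-unique {s} {s′} (≡6s+4 e) (≡6s+4 e′) = quotient-unique 6 s s′ (trans (sym e) e′)
lengthForm-unique {s} {s′} (≡6s+1 e) (≡6s+4 e′) =
  contradiction (remainder-unique 6 s s′ (trans (sym e) e′)) λ ()
lengthForm-unique {s} {s′} (≡6s+4 e) (≡6s+1 e′) =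
  contradiction (remainder-unique 6 s s′ (trans (sym e) e′)) λ ()
lengthForm-unique {s} {s′} (≡3s+2 e) (≡6s+1 e′) =
  ⊥-elim (residues-differ s (2 * s′) (λ ()) e (trans e′ (6s+1≡3[2s]+1 s′)))
lengthForm-unique {s} {s′} (≡3s+2 e) (≡6s+4 e′) =
  ⊥-elim (residues-differ s (2 * s′ + 1) (λ ()) e (trans e′ (6s+4≡3[2s+1]+1 s′)))
lengthForm-unique {s} {s′} (≡6s+1 e) (≡3s+2 e′) =
  ⊥-elim (residues-differ s′ (2 * s) (λ ()) e′ (trans e (6s+1≡3[2s]+1 s)))
lengthForm-unique {s} {s′} (≡6s+4 e) (≡3s+2 e′) =
  ⊥-elim (residues-differ s′ (2 * s + 1) (λ ()) e′ (trans e (6s+4≡3[2s+1]+1 s)))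

lengthForm-bound : ∀ {s m} → LengthForm s m → 3 * s < m
lengthForm-bound {s} (≡3s+2 refl) = m<m+n (3 * s) z<s
lengthForm-bound {s} (≡6s+1 refl) = ≤-<-trans (*-monoˡ-≤ s {3} {6} (s≤s (s≤s (s≤s z≤n)))) (m<m+n (6 * s) z<s)
lengthForm-bound {s} (≡6s+4 refl) = ≤-<-trans (*-monoˡ-≤ s {3} {6} (s≤s (s≤s (s≤s z≤n)))) (m<m+n (6 * s) z<s)

-- DeletedPos uniformly in the three length forms: the front positions 3, 6, …, 3s and the back
-- positions 3s+2, 3s+5, …, m−2 (none when m = 3s+2).
data DeletedView (m j : ℕ) : Set where
  front : ∀ {s} t → LengthForm s m → 1 ≤ t → t ≤ s → j ≡ 3 * t → DeletedView m j
  back  : ∀ {s} u → LengthForm s m → s ≤ u → j ≡ 3 * u + 2 → j + 2 ≤ m → DeletedView m j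

deleted⇒view : ∀ {m j} → DeletedPos m j → DeletedView m j
deleted⇒view (mod2 q t 1≤t le) =
  front {s = q} t (≡3s+2 refl) 1≤t (*-cancelˡ-≤ 3 (+-cancelʳ-≤ 2 (3 * t) (3 * q) le)) refl
deleted⇒view (m1a p t 1≤t t≤p) = front {s = p} t (≡6s+1 refl) 1≤t t≤p refl
deleted⇒view (m4a p t 1≤t t≤p) = front {s = p} t (≡6s+4 refl) 1≤t t≤p refl
deleted⇒view (m1b p t le) =
  back {s = p} (p + t) (≡6s+1 refl) (m≤m+n p t) (3p+2+3t≡3[p+t]+2 p t)
    (subst (_≤ 6 * p + 1) (+-assoc _ 1 1) (+-monoˡ-≤ 1 le))
deleted⇒view (m4b p t le) =
  back {s = p} (p + t) (≡6s+4 refl) (m≤m+n p t) (3p+2+3t≡3[p+t]+2 p t)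
    (subst (3 * p + 2 + 3 * t + 2 ≤_) (+-assoc (6 * p) 2 2) (+-monoˡ-≤ 2 le))

view⇒deleted : ∀ {m j} → DeletedView m j → DeletedPos m j
view⇒deleted (front {s} t (≡3s+2 refl) 1≤t t≤s refl) = mod2 s t 1≤t (+-monoˡ-≤ 2 (*-monoʳ-≤ 3 t≤s))
view⇒deleted (front {s} t (≡6s+1 refl) 1≤t t≤s refl) = m1a s t 1≤t t≤s
view⇒deleted (front {s} t (≡6s+4 refl) 1≤t t≤s refl) = m4a s t 1≤t t≤s
view⇒deleted (back u (≡3s+2 refl) s≤u refl le) =
  contradiction (≤-trans le (+-monoˡ-≤ 2 (*-monoʳ-≤ 3 s≤u))) (m+1+n≰m (3 * u + 2))
view⇒deleted (back {s} u (≡6s+1 refl) s≤u refl le) with m≤n⇒∃[o]m+o≡n s≤u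
... | t , refl rewrite sym (3p+2+3t≡3[p+t]+2 s t) =
  m1b s t (+-cancelʳ-≤ 1 _ _ (subst (_≤ 6 * s + 1) (sym (+-assoc _ 1 1)) le))
view⇒deleted (back {s} u (≡6s+4 refl) s≤u refl le) with m≤n⇒∃[o]m+o≡n s≤u
... | t , refl rewrite sym (3p+2+3t≡3[p+t]+2 s t) =
  m4b s t (+-cancelʳ-≤ 2 _ _ (subst (3 * s + 2 + 3 * t + 2 ≤_) (sym (+-assoc (6 * s) 2 2)) le))

first-not-deleted : ∀ {m} → ¬ DeletedPos m 1
first-not-deleted d with deleted⇒view d
... | front t _ 1≤t _ 1≡3t =
  contradiction (≤-trans (*-monoʳ-≤ 3 1≤t) (≤-reflexive (sym 1≡3t))) λ { (s≤s ()) }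
... | back u _ _ 1≡3u+2 _ =
  contradiction (≤-trans (m≤n+m 2 (3 * u)) (≤-reflexive (sym 1≡3u+2))) λ { (s≤s ()) }

last-not-deleted : ∀ {m} → ¬ DeletedPos m m
last-not-deleted {m} d with deleted⇒view d
... | front t form _ t≤s m≡3t =
  <-irrefl refl (≤-<-trans (≤-trans (≤-reflexive m≡3t) (*-monoʳ-≤ 3 t≤s)) (lengthForm-bound form))
... | back _ _ _ _ m+2≤m = m+1+n≰m m m+2≤m

adjacent-not-deleted : ∀ {m j} → DeletedPos m j → ¬ DeletedPos m (suc j)
adjacent-not-deleted d d′ with deleted⇒view d | deleted⇒view d′
... | front t _ _ _ j≡3t | front t′ _ _ _ j+1≡3t′ =
  residues-differ t t′ (λ ()) (j≡3t⇒1+j≡3t+1 t j≡3t) (trans j+1≡3t′ (sym (+-identityʳ (3 * t′))))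
... | front t _ _ _ j≡3t | back u′ _ _ j+1≡3u′+2 _ =
  residues-differ t u′ (λ ()) (j≡3t⇒1+j≡3t+1 t j≡3t) j+1≡3u′+2
... | back u _ _ j≡3u+2 _ | back u′ _ _ j+1≡3u′+2 _ =
  residues-differ (suc u) u′ (λ ()) (j≡3u+2⇒1+j≡3[1+u] u j≡3u+2) j+1≡3u′+2
... | back u form s≤u j≡3u+2 _ | front t′ form′ _ t′≤s′ j+1≡3t′ =
  contradiction (≤-trans t′≤s′ (≤-reflexive (lengthForm-unique form′ form)))
                (<⇒≱ (≤-trans (s≤s s≤u) (≤-reflexive (sym t′≡1+u))))
  where
  t′≡1+u = *-cancelˡ-≡ t′ (suc u) 3
             (trans (sym j+1≡3t′) (trans (j≡3u+2⇒1+j≡3[1+u] u j≡3u+2) (+-identityʳ _)))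

-- If w ≤ s the multiple 3w is a front position; otherwise s ≤ u and 3u+2 is a back position,
-- because then m ≡ 1 (mod 3) leaves room for two more edges after it.
multiple-or-back : ∀ {s m w u} → LengthForm s m → 1 ≤ w → w ≤ suc u → 3 * w ≤ m → 3 * u + 2 ≤ m →
                   DeletedView m (3 * w) ⊎ DeletedView m (3 * u + 2)
multiple-or-back {s} {m} {w} {u} form 1≤w w≤1+u 3w≤m 3u+2≤m with w ≤? s
... | yes w≤s = inj₁ (front w form 1≤w w≤s refl)
... | no w≰s  = inj₂ (back u form (≤-pred (≤-trans (≰⇒> w≰s) w≤1+u)) refl (room form))
  where
  room-below : ∀ {n} → m ≡ 3 * n + 1 → 3 * u + 2 + 2 ≤ m
  room-below {n} m≡ = subst (3 * u + 2 + 2 ≤_) (sym m≡)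
    (3u+2≤3n+1⇒3u+4≤3n+1 u n (subst (3 * u + 2 ≤_) m≡ 3u+2≤m))
  room : LengthForm s m → 3 * u + 2 + 2 ≤ m
  room (≡3s+2 m≡) = contradiction (3*m≤3*n+2⇒m≤n w s (subst (3 * w ≤_) m≡ 3w≤m)) w≰s
  room (≡6s+1 m≡) = room-below {2 * s} (trans m≡ (6s+1≡3[2s]+1 s))
  room (≡6s+4 m≡) = room-below {2 * s + 1} (trans m≡ (6s+4≡3[2s+1]+1 s))

deleted-at : ∀ {m j j′} → j ≡ j′ → DeletedView m j → DeletedPos m j′
deleted-at refl = view⇒deleted

deleted-in-window : ∀ {m i} → ¬ 3 ∣ m → 1 ≤ i → 2 + i ≤ m →
                    DeletedPos m i ⊎ DeletedPos m (1 + i) ⊎ DeletedPos m (2 + i)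
deleted-in-window {m} {i} 3∤m 1≤i 2+i≤m with proj₂ (lengthForm 3∤m) | i divMod 3
... | _ | result zero 0F refl = contradiction 1≤i λ ()
... | form | result (suc u) 0F refl =
  [ inj₁ ∘ deleted-at (sym e₀) , inj₂ ∘ inj₂ ∘ deleted-at (sym e₂) ]′
    (multiple-or-back form (s≤s z≤n) (n≤1+n (suc u))
      (subst (_≤ m) e₀ (m+n≤o⇒n≤o 2 2+i≤m)) (subst (_≤ m) e₂ 2+i≤m))
  where
  e₀ : suc u * 3 ≡ 3 * suc u
  e₀ = solve (u ∷ [])
  e₂ : 2 + suc u * 3 ≡ 3 * suc u + 2
  e₂ = solve (u ∷ [])
... | form | result u 1F refl =
  [ inj₂ ∘ inj₂ ∘ deleted-at (sym e₂) , inj₂ ∘ inj₁ ∘ deleted-at (sym e₁) ]′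
    (multiple-or-back form (s≤s z≤n) ≤-refl
      (subst (_≤ m) e₂ 2+i≤m) (subst (_≤ m) e₁ (m+n≤o⇒n≤o 1 2+i≤m)))
  where
  e₁ : 1 + (1 + u * 3) ≡ 3 * u + 2
  e₁ = solve (u ∷ [])
  e₂ : 2 + (1 + u * 3) ≡ 3 * suc u
  e₂ = solve (u ∷ [])
... | form | result u 2F refl =
  [ inj₂ ∘ inj₁ ∘ deleted-at (sym e₁) , inj₁ ∘ deleted-at (sym e₀) ]′
    (multiple-or-back form (s≤s z≤n) ≤-refl
      (subst (_≤ m) e₁ (m+n≤o⇒n≤o 1 2+i≤m)) (subst (_≤ m) e₀ (m+n≤o⇒n≤o 2 2+i≤m)))
  where
  e₀ : 2 + u * 3 ≡ 3 * u + 2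
  e₀ = solve (u ∷ [])
  e₁ : 1 + (2 + u * 3) ≡ 3 * suc u
  e₁ = solve (u ∷ [])

bounded-∃? : ∀ {P : ℕ → Set} → (∀ n → Dec (P n)) → ∀ b → (∀ {n} → P n → n < b) → Dec (∃ P)
bounded-∃? P? b bound =
  map′ (λ (n , _ , pn) → n , pn) (λ (n , pn) → n , bound pn , pn) (anyUpTo? P? b)

lengthForm? : ∀ s m → Dec (LengthForm s m)
lengthForm? s m = map′ to from ((m ≟ 3 * s + 2) ⊎-dec (m ≟ 6 * s + 1) ⊎-dec (m ≟ 6 * s + 4))
  where
  Forms = (m ≡ 3 * s + 2) ⊎ (m ≡ 6 * s + 1) ⊎ (m ≡ 6 * s + 4)
  to : Forms → LengthForm s m
  to = [ ≡3s+2 , [ ≡6s+1 , ≡6s+4 ]′ ]′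
  from : LengthForm s m → Forms
  from (≡3s+2 e) = inj₁ e
  from (≡6s+1 e) = inj₂ (inj₁ e)
  from (≡6s+4 e) = inj₂ (inj₂ e)

deleted-view? : ∀ m j → Dec (DeletedView m j)
deleted-view? m j = map′ to from
  (bounded-∃? front? (suc m) (s<1+m ∘ proj₁ ∘ proj₂) ⊎-dec bounded-∃? back? (suc m) (s<1+m ∘ proj₁ ∘ proj₂))
  where
  Front Back : ℕ → ℕ → Set
  Front s t = LengthForm s m × 1 ≤ t × t ≤ s × j ≡ 3 * t
  Back s u  = LengthForm s m × s ≤ u × j ≡ 3 * u + 2 × j + 2 ≤ m
  s<1+m : ∀ {s} → LengthForm s m → s < suc m
  s<1+m {s} form = s≤s (≤-trans (m≤n*m s 3) (<⇒≤ (lengthForm-bound form)))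
  front? : ∀ s → Dec (∃ (Front s))
  front? s = bounded-∃? (λ t → lengthForm? s m ×-dec 1 ≤? t ×-dec t ≤? s ×-dec j ≟ 3 * t) (suc j)
    λ (_ , _ , _ , j≡3t) → s≤s (≤-trans (m≤n*m _ 3) (≤-reflexive (sym j≡3t)))
  back? : ∀ s → Dec (∃ (Back s))
  back? s = bounded-∃? (λ u → lengthForm? s m ×-dec s ≤? u ×-dec j ≟ 3 * u + 2 ×-dec j + 2 ≤? m) (suc j)
    λ (_ , _ , j≡3u+2 , _) → s≤s (≤-trans (m≤n*m _ 3) (≤-trans (m≤m+n _ 2) (≤-reflexive (sym j≡3u+2))))
  to : (∃ λ s → ∃ (Front s)) ⊎ (∃ λ s → ∃ (Back s)) → DeletedView m j
  to (inj₁ (_ , t , form , 1≤t , t≤s , j≡3t)) = front t form 1≤t t≤s j≡3t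
  to (inj₂ (_ , u , form , s≤u , j≡3u+2 , room)) = back u form s≤u j≡3u+2 room
  from : DeletedView m j → (∃ λ s → ∃ (Front s)) ⊎ (∃ λ s → ∃ (Back s))
  from (front t form 1≤t t≤s j≡3t) = inj₁ (_ , t , form , 1≤t , t≤s , j≡3t)
  from (back u form s≤u j≡3u+2 room) = inj₂ (_ , u , form , s≤u , j≡3u+2 , room)

deleted? : ∀ m j → Dec (DeletedPos m j)
deleted? m j = map′ view⇒deleted deleted⇒view (deleted-view? m j)

mult≡suc⇒∈ : ∀ {v k} xs → mult v xs ≡ suc k → v ∈ xs
mult≡suc⇒∈ {v} (x ∷ xs) eq with v ≟ x
... | yes refl = here refl
... | no v≢x   = there (mult≡suc⇒∈ xs (trans (sym (cong length (filter-reject (v ≟_) v≢x))) eq))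

inhabited⇔true : ∀ {a} {A : Set a} → A → A ⇔ T true
inhabited⇔true x = mk⇔ _ (λ _ → x)

empty⇔false : ∀ {a} {A : Set a} → ¬ A → A ⇔ T false
empty⇔false ¬x = mk⇔ ¬x λ ()

close-above : ∀ {P L : ℕ → Set} {b} → (∀ y → L y → y < b → P y) → P b →
              ∀ y → L y → y ≤ b → P y
close-above below top y ly y≤b with m≤n⇒m<n∨m≡n y≤b
... | inj₁ y<b = below y ly y<b
... | inj₂ refl = top

close-below : ∀ {P U : ℕ → Set} {a} → P a → (∀ y → a < y → U y → P y) →
              ∀ y → a ≤ y → U y → P y
close-below bottom above y a≤y uy with m≤n⇒m<n∨m≡n a≤y
... | inj₁ a<y = above y a<y uy
... | inj₂ refl = bottom

join-at : ∀ {P L U : ℕ → Set} v → (∀ y → L y → y ≤ v → P y) → (∀ y → suc v ≤ y → U y → P y) →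
          ∀ y → L y → U y → P y
join-at v below above y ly uy with y ≤? v
... | yes y≤v = below y ly y≤v
... | no y≰v  = above y (≰⇒> y≰v) uy

open Pattern using (size; offset; edge)

module Components (p : List ℕ) (positive : All (1 ≤_) p) (admissible : Admissible p) where

  μ₁ μ₂ : ℕ → Set
  μ₁ = InMu1 p
  μ₂ = InMu2 p

  μ₁? : ∀ v → Dec (μ₁ v)
  μ₁? v = v ∈? p

  μ₂? : ∀ v → Dec (μ₂ v)
  μ₂? v = mult v p ≟ 2

  μ₂⇒μ₁ : ∀ {v} → μ₂ v → μ₁ v
  μ₂⇒μ₁ = mult≡suc⇒∈ p

  μ₁-bounded : ∀ {v} → μ₁ v → v ≤ max 0 p
  μ₁-bounded = All.lookup (xs≤max 0 p)

  μ₁-positive : ∀ {v} → μ₁ v → 1 ≤ v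
  μ₁-positive = All.lookup positive

  -- Chains

  -- An end of a chain: a doubled value (the chain continues with its hanging edge), or a value
  -- that is not doubled and where the run stops.
  End : Bool → ℕ → Set → Set
  End true  v _    = μ₂ v
  End false v stop = ¬ μ₂ v × stop

  LeftEnd : Bool → ℕ → Set
  LeftEnd lh l = End lh l (RunStart p l)

  RightEnd : Bool → ℕ → Set
  RightEnd rh r = End rh r (RunEnd p r)

  end-unique : ∀ {b b′ v X Y} → End b v X → End b′ v Y → b ≡ b′
  end-unique {true}  {true}  _ _ = refl
  end-unique {false} {false} _ _ = refl
  end-unique {true}  {false} d (¬d , _) = contradiction d ¬d
  end-unique {false} {true}  (¬d , _) d = contradiction d ¬d

  -- IsChain with its four cases merged, for chains with at least one backbone edge.
  record ChainShape (lh : Bool) (l r : ℕ) (rh : Bool) : Set where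
    field
      run      : RunIn p l r
      leftEnd  : LeftEnd lh l
      rightEnd : RightEnd rh r
      inner    : ∀ v → l < v → v < r → ¬ μ₂ v

  open ChainShape

  chain⇒shape : ∀ {lh l r rh} → IsChain p lh l r rh → l < r → ChainShape lh l r rh
  chain⇒shape (noDouble k n k≤n run start end single) _ = record
    { run = run ; leftEnd = single k ≤-refl k≤n , start ; rightEnd = single n k≤n ≤-refl , end
    ; inner = λ v k<v v<n → single v (<⇒≤ k<v) (<⇒≤ v<n) }
  chain⇒shape (first k a k≤a run start doubled single) k<a = record
    { run = run ; leftEnd = single k ≤-refl k<a , start ; rightEnd = doubled
    ; inner = λ v k<v v<a → single v (<⇒≤ k<v) v<a }
  chain⇒shape (middle a b a<b run doubledˡ doubledʳ single) _ = record
    { run = run ; leftEnd = doubledˡ ; rightEnd = doubledʳ ; inner = single }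
  chain⇒shape (last a n a≤n run doubled end single) a<n = record
    { run = run ; leftEnd = doubled ; rightEnd = single n a<n ≤-refl , end
    ; inner = λ v a<v v<n → single v a<v (<⇒≤ v<n) }

  shape⇒chain : ∀ {lh l r rh} → ChainShape lh l r rh → l < r → IsChain p lh l r rh
  shape⇒chain {false} {l} {r} {false} c l<r =
    noDouble l r (<⇒≤ l<r) (run c) (proj₂ (leftEnd c)) (proj₂ (rightEnd c))
      (close-below (proj₁ (leftEnd c)) (close-above (inner c) (proj₁ (rightEnd c))))
  shape⇒chain {false} {l} {r} {true} c l<r =
    first l r (<⇒≤ l<r) (run c) (proj₂ (leftEnd c)) (rightEnd c) (close-below (proj₁ (leftEnd c)) (inner c))
  shape⇒chain {true} {l} {r} {true} c l<r =
    middle l r l<r (run c) (leftEnd c) (rightEnd c) (inner c)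
  shape⇒chain {true} {l} {r} {false} c l<r =
    last l r (<⇒≤ l<r) (run c) (leftEnd c) (proj₂ (rightEnd c)) (close-above (inner c) (proj₁ (rightEnd c)))

  -- An end of one chain strictly inside another would be a doubled inner value or would
  -- contradict the maximality of the run.
  start-not-inside : ∀ {lh l r rh lh′ l′ r′ rh′} → ChainShape lh l r rh → ChainShape lh′ l′ r′ rh′ →
                     l < l′ → l′ < r → ⊥
  start-not-inside {l′ = zero} _ _ () _
  start-not-inside {lh′ = true} {l′ = suc k} c c′ l<l′ l′<r = inner c (suc k) l<l′ l′<r (leftEnd c′)
  start-not-inside {lh′ = false} {l′ = suc k} c c′ l<l′ l′<r =
    proj₂ (leftEnd c′) k refl (run c k (≤-pred l<l′) (≤-trans (n≤1+n k) (<⇒≤ l′<r)))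

  end-not-inside : ∀ {lh l r rh lh′ l′ r′ rh′} → ChainShape lh l r rh → ChainShape lh′ l′ r′ rh′ →
                   l′ < r → r < r′ → ⊥
  end-not-inside {rh = true}  c c′ l′<r r<r′ = inner c′ _ l′<r r<r′ (rightEnd c)
  end-not-inside {r = r} {rh = false} c c′ l′<r r<r′ =
    proj₂ (rightEnd c) (run c′ (suc r) (≤-trans (<⇒≤ l′<r) (n≤1+n r)) r<r′)

  shape-unique : ∀ {lh l r rh lh′ l′ r′ rh′ v} → ChainShape lh l r rh → ChainShape lh′ l′ r′ rh′ →
                 l ≤ v → v < r → l′ ≤ v → v < r′ → lh ≡ lh′ × l ≡ l′ × r ≡ r′ × rh ≡ rh′
  shape-unique {l = l} {r} {l′ = l′} {r′} c c′ l≤v v<r l′≤v v<r′ with <-cmp l l′ | <-cmp r r′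
  ... | tri< l<l′ _ _ | _ = ⊥-elim (start-not-inside c c′ l<l′ (≤-<-trans l′≤v v<r))
  ... | tri> _ _ l′<l | _ = ⊥-elim (start-not-inside c′ c l′<l (≤-<-trans l≤v v<r′))
  ... | tri≈ _ _ _ | tri< r<r′ _ _ = ⊥-elim (end-not-inside c c′ (≤-<-trans l′≤v v<r) r<r′)
  ... | tri≈ _ _ _ | tri> _ _ r′<r = ⊥-elim (end-not-inside c′ c (≤-<-trans l≤v v<r′) r′<r)
  ... | tri≈ _ refl _ | tri≈ _ refl _ =
    end-unique (leftEnd c) (leftEnd c′) , refl , refl , end-unique (rightEnd c) (rightEnd c′)

  record LeftPart (v : ℕ) : Set where
    field
      lh    : Bool
      l     : ℕ
      l≤v   : l ≤ v
      run   : RunIn p l v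
      end   : LeftEnd lh l
      inner : ∀ y → l < y → y ≤ v → ¬ μ₂ y

  record RightPart (v : ℕ) : Set where
    field
      rh    : Bool
      r     : ℕ
      v≤r   : v ≤ r
      run   : RunIn p v r
      end   : RightEnd rh r
      inner : ∀ y → v ≤ y → y < r → ¬ μ₂ y

  point-run : ∀ {v} → μ₁ v → RunIn p v v
  point-run v∈ y v≤y y≤v = subst μ₁ (≤-antisym v≤y y≤v) v∈

  point-inner : ∀ {v} y → v < y → y ≤ v → ¬ μ₂ y
  point-inner y v<y y≤v = contradiction y≤v (<⇒≱ v<y)

  leftPoint : ∀ {lh v} → μ₁ v → LeftEnd lh v → LeftPart v
  leftPoint {lh} {v} v∈ end = record
    { lh = lh ; l = v ; l≤v = ≤-refl ; run = point-run v∈ ; end = end ; inner = point-inner }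

  rightPoint : ∀ {rh v} → μ₁ v → RightEnd rh v → RightPart v
  rightPoint {rh} {v} v∈ end = record
    { rh = rh ; r = v ; v≤r = ≤-refl ; run = point-run v∈ ; end = end
    ; inner = λ y v≤y y<v → contradiction v≤y (<⇒≱ y<v) }

  leftPart : ∀ v → μ₁ v → LeftPart v
  leftPart v v∈ with μ₂? v
  ... | yes d = leftPoint v∈ d
  leftPart zero v∈ | no ¬d = leftPoint v∈ (¬d , λ _ ())
  leftPart (suc u) v∈ | no ¬d with μ₁? u
  ... | no u∉ = leftPoint v∈ (¬d , λ { _ refl → u∉ })
  ... | yes u∈ = record
    { lh = L.lh ; l = L.l ; l≤v = ≤-trans L.l≤v (n≤1+n u) ; end = L.end
    ; run = close-above (λ y l≤y y≤u → L.run y l≤y (≤-pred y≤u)) v∈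
    ; inner = close-above (λ y l<y y≤u → L.inner y l<y (≤-pred y≤u)) ¬d }
    where module L = LeftPart (leftPart u u∈)

  rightPart : ∀ v → μ₁ v → RightPart v
  rightPart v = walk (max 0 p) v (m≤m+n (max 0 p) v)
    where
    walk : ∀ fuel v → max 0 p ≤ fuel + v → μ₁ v → RightPart v
    walk fuel v bound v∈ with μ₂? v
    ... | yes d = rightPoint v∈ d
    ... | no ¬d with μ₁? (suc v)
    ...   | no v+1∉ = rightPoint v∈ (¬d , v+1∉)
    walk zero v bound v∈ | no ¬d | yes v+1∈ = ⊥-elim (<-irrefl refl (≤-trans (μ₁-bounded v+1∈) bound))
    walk (suc fuel) v bound v∈ | no ¬d | yes v+1∈ = record
      { rh = R.rh ; r = R.r ; v≤r = ≤-trans (n≤1+n v) R.v≤r ; end = R.end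
      ; run = close-below v∈ R.run ; inner = close-below ¬d R.inner }
      where module R = RightPart (walk fuel (suc v) (subst (max 0 p ≤_) (sym (+-suc fuel v)) bound) v+1∈)

  data ChainAt (v : ℕ) : Set where
    chain : ∀ lh l r rh → IsChain p lh l r rh → l ≤ v → v < r → ChainAt v

  chainAt : ∀ {v} → μ₁ v → μ₁ (suc v) → ChainAt v
  chainAt {v} v∈ v+1∈ = chain L.lh L.l R.r R.rh (shape⇒chain shape (≤-<-trans L.l≤v R.v≤r)) L.l≤v R.v≤r
    where
    module L = LeftPart (leftPart v v∈)
    module R = RightPart (rightPart (suc v) v+1∈)
    shape : ChainShape L.lh L.l R.r R.rh
    shape = record { run = join-at v L.run R.run ; leftEnd = L.end ; rightEnd = R.end
                   ; inner = join-at v L.inner R.inner }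

  position : Bool → ℕ → ℕ → ℕ
  position lh l w = suc (w ∸ l) + b2n lh

  position-start : ∀ lh l → position lh l l ≡ suc (b2n lh)
  position-start lh l = cong (λ x → suc x + b2n lh) (n∸n≡0 l)

  position-suc : ∀ {lh l w} → l ≤ w → position lh l (suc w) ≡ suc (position lh l w)
  position-suc {lh} l≤w = cong (λ x → suc x + b2n lh) (+-∸-assoc 1 l≤w)

  position-end : ∀ {lh l w} rh → l ≤ w → position lh l w + b2n rh ≡ chainLength lh l (suc w) rh
  position-end {lh} {l} {w} rh l≤w = begin
    suc (w ∸ l) + b2n lh + b2n rh   ≡⟨ swap (w ∸ l) (b2n lh) (b2n rh) ⟩
    b2n lh + suc (w ∸ l) + b2n rh   ≡⟨ cong (λ x → b2n lh + x + b2n rh) (+-∸-assoc 1 l≤w) ⟨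
    b2n lh + (suc w ∸ l) + b2n rh   ∎
    where
    open ≡-Reasoning
    swap : ∀ x a b → suc x + a + b ≡ a + suc x + b
    swap = solve-∀

  backbone-edge : ∀ {lh l r rh w} → l ≤ w → w < r →
                  ChainEdge lh l r rh (position lh l w) (w , false) (suc w , false)
  backbone-edge {lh} {l} {r} {rh} {w} l≤w w<r =
    subst (λ z → ChainEdge lh l r rh (position lh l w) (z , false) (suc z , false)) (m+[n∸m]≡n l≤w)
      (back lh l r rh (w ∸ l) (∸-monoˡ-< w<r l≤w))

  backbone-edge⁻¹ : ∀ {lh l r rh j w w′} → ChainEdge lh l r rh j (w , false) (w′ , false) →
                    w′ ≡ suc w × l ≤ w × w < r × j ≡ position lh l w
  backbone-edge⁻¹ (back lh l r rh i i<r∸l) =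
    refl , m≤m+n l i , subst (l + i <_) (m+[n∸m]≡n (<⇒≤ l<r)) (+-monoʳ-< l i<r∸l) ,
    cong (λ x → suc x + b2n lh) (sym (m+n∸m≡n l i))
    where
    l<r : l < r
    l<r = m∸n≢0⇒n<m (λ r∸l≡0 → n≮0 (subst (i <_) r∸l≡0 i<r∸l))

  chainEdge-bounds : ∀ {lh l r rh j x y} → ChainEdge lh l r rh j x y → 1 ≤ j × j ≤ chainLength lh l r rh
  chainEdge-bounds (hangL l r rh) = ≤-refl , s≤s z≤n
  chainEdge-bounds (back lh l r rh i i<r∸l) = s≤s z≤n , (begin
    suc i + b2n lh                ≤⟨ +-monoˡ-≤ (b2n lh) i<r∸l ⟩
    (r ∸ l) + b2n lh              ≡⟨ +-comm (r ∸ l) (b2n lh) ⟩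
    b2n lh + (r ∸ l)              ≤⟨ m≤m+n (b2n lh + (r ∸ l)) (b2n rh) ⟩
    b2n lh + (r ∸ l) + b2n rh     ∎)
    where open ≤-Reasoning
  chainEdge-bounds (hangR lh l r) = m≤n+m 1 _ , ≤-refl

  Adj'-sym : ∀ {x y} → Adj' p x y → Adj' p y x
  Adj'-sym (e , ¬del , ¬del′) = Data.Sum.swap e , ¬del′ , ¬del

  Adj'-irrefl : ∀ {x} → ¬ Adj' p x x
  Adj'-irrefl (inj₁ () , _)
  Adj'-irrefl (inj₂ () , _)

  ¬Adj'-skip : ∀ {v b c} → ¬ Adj' p (v , b) (suc (suc v) , c)
  ¬Adj'-skip (inj₁ () , _)
  ¬Adj'-skip (inj₂ () , _)

  ¬Adj'-twin-next : ∀ {v b} → ¬ Adj' p (v , true) (suc v , b)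
  ¬Adj'-twin-next (inj₁ () , _)
  ¬Adj'-twin-next (inj₂ () , _)

  ¬Adj'-next-twin : ∀ {v b} → ¬ Adj' p (v , b) (suc v , true)
  ¬Adj'-next-twin (inj₁ () , _)
  ¬Adj'-next-twin (inj₂ () , _)

  Kept : ℕ → Set
  Kept v = Adj' p (v , false) (suc v , false)

  kept⇒μ₁ : ∀ {v} → Kept v → μ₁ v × μ₁ (suc v)
  kept⇒μ₁ (inj₁ (backbone _ v∈ v+1∈) , _) = v∈ , v+1∈

  adjacent⇒not-deleted : ∀ {lh l r rh j x y} → IsChain p lh l r rh → ChainEdge lh l r rh j x y →
                         Adj' p x y → ¬ DeletedPos (chainLength lh l r rh) j
  adjacent⇒not-deleted ch e (_ , ¬del , _) del = ¬del (_ , _ , _ , _ , _ , ch , e , del)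

  -- The chain through w is the only one containing the edge w—w+1 (shape-unique), and no
  -- chain lists it in the opposite orientation.
  not-deleted⇒kept : ∀ {lh l r rh w} → IsChain p lh l r rh → l ≤ w → w < r →
                     ¬ DeletedPos (chainLength lh l r rh) (position lh l w) → Kept w
  not-deleted⇒kept {w = w} ch l≤w w<r ¬del =
    inj₁ (backbone w (run c w l≤w (<⇒≤ w<r)) (run c (suc w) (≤-trans l≤w (n≤1+n w)) w<r)) ,
    forward , backward
    where
    c = chain⇒shape ch (≤-<-trans l≤w w<r)
    forward : ¬ Deleted p (w , false) (suc w , false)
    forward (_ , _ , _ , _ , _ , ch′ , e , del) with backbone-edge⁻¹ e
    ... | _ , l′≤w , w<r′ , refl
      with shape-unique c (chain⇒shape ch′ (≤-<-trans l′≤w w<r′)) l≤w w<r l′≤w w<r′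
    ... | refl , refl , refl , refl = ¬del del
    backward : ¬ Deleted p (suc w , false) (w , false)
    backward (_ , _ , _ , _ , _ , _ , e , _) with backbone-edge⁻¹ e
    ... | () , _

  -- A hanging edge is the first or the last edge of its chain.
  hanging-kept : ∀ {v} → μ₂ v → Adj' p (v , false) (v , true)
  hanging-kept {v} d = inj₁ (hanging v d) , forward , backward
    where
    forward : ¬ Deleted p (v , false) (v , true)
    forward (_ , _ , _ , _ , _ , _ , hangR _ _ _ , del) = last-not-deleted del
    backward : ¬ Deleted p (v , true) (v , false)
    backward (_ , _ , _ , _ , _ , _ , hangL _ _ _ , del) = first-not-deleted del

  kept? : ∀ v → Dec (Kept v)
  kept? v with μ₁? v | μ₁? (suc v)
  ... | no v∉  | _         = no (v∉ ∘ proj₁ ∘ kept⇒μ₁)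
  ... | yes _  | no v+1∉   = no (v+1∉ ∘ proj₂ ∘ kept⇒μ₁)
  ... | yes v∈ | yes v+1∈ with chainAt v∈ v+1∈
  ... | chain lh l r rh ch l≤v v<r with deleted? (chainLength lh l r rh) (position lh l v)
  ...   | yes del = no λ k → adjacent⇒not-deleted ch (backbone-edge l≤v v<r) k del
  ...   | no ¬del = yes (not-deleted⇒kept ch l≤v v<r ¬del)

  data Neighbour (w : ℕ) : Vertex → Set where
    next : Kept w → Neighbour w (suc w , false)
    twin : μ₂ w → Neighbour w (w , true)
    prev : ∀ {v} → suc v ≡ w → Kept v → Neighbour w (v , false)

  neighbour : ∀ {w y} → Adj' p (w , false) y → Neighbour w y
  neighbour k@(inj₁ (backbone _ _ _) , _) = next k
  neighbour (inj₁ (hanging _ d) , _)      = twin d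
  neighbour k@(inj₂ (backbone _ _ _) , _) = prev refl (Adj'-sym k)

  twin-neighbour : ∀ {w y} → Adj' p (w , true) y → y ≡ (w , false)
  twin-neighbour (inj₂ (hanging _ _) , _) = refl

  -- Local structure of G'_λ

  -- An isolated vertex of G_λ is a chain without edges, which admissibility excludes.
  no-isolated : ∀ {v} → μ₁ v → ¬ μ₂ v → RunStart p v → RunEnd p v → ⊥
  no-isolated {v} v∈ ¬d start end =
    admissible false v v false
      (noDouble v v ≤-refl (point-run v∈) start end
        (λ y v≤y y≤v → subst (¬_ ∘ μ₂) (≤-antisym v≤y y≤v) ¬d))
      (divides 0 (trans (+-identityʳ (v ∸ v)) (n∸n≡0 v)))

  no-adjacent-doubles : ∀ {v} → μ₂ v → ¬ μ₂ (suc v)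
  no-adjacent-doubles {v} d d′ =
    admissible true v (suc v) true (middle v (suc v) (n<1+n v) pair-run d d′ pair-inner)
      (divides 1 (cong (λ x → 1 + x + 1) (m+n∸n≡m 1 v)))
    where
    pair-run : RunIn p v (suc v)
    pair-run = close-above (λ y v≤y y≤v → point-run (μ₂⇒μ₁ d) y v≤y (≤-pred y≤v)) (μ₂⇒μ₁ d′)
    pair-inner : ∀ y → v < y → y < suc v → ¬ μ₂ y
    pair-inner y v<y y<1+v = point-inner y v<y (≤-pred y<1+v)

  left-neighbour? : ∀ v → (∃ λ u → suc u ≡ v × μ₁ u) ⊎ RunStart p v
  left-neighbour? zero = inj₂ λ _ ()
  left-neighbour? (suc u) with μ₁? u
  ... | yes u∈ = inj₁ (u , refl , u∈)
  ... | no u∉  = inj₂ λ { _ refl → u∉ }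

  reindex : ∀ {lh l r rh j j′ x y} → j ≡ j′ → ChainEdge lh l r rh j x y → ChainEdge lh l r rh j′ x y
  reindex refl e = e

  kept-in-chain : ∀ {v} → ChainAt v → ¬ μ₂ v → (∃ λ u → suc u ≡ v × Kept u) ⊎ Kept v
  kept-in-chain (chain lh l r rh ch l≤v v<r) ¬d with m≤n⇒m<n∨m≡n l≤v
  kept-in-chain (chain true l r rh ch l≤v v<r) ¬d | inj₂ refl =
    contradiction (leftEnd (chain⇒shape ch v<r)) ¬d
  kept-in-chain (chain false l r rh ch l≤v v<r) ¬d | inj₂ refl =
    inj₂ (not-deleted⇒kept ch l≤v v<r (first-not-deleted ∘ subst (DeletedPos _) (position-start false l)))
  kept-in-chain {suc u} (chain lh l r rh ch l≤v v<r) ¬d | inj₁ l<v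
    with deleted? (chainLength lh l r rh) (position lh l (suc u))
  ... | no ¬del = inj₂ (not-deleted⇒kept ch l≤v v<r ¬del)
  ... | yes del = inj₁ (u , refl , not-deleted⇒kept ch (≤-pred l<v) (≤-trans (n≤1+n (suc u)) v<r)
                    λ del′ → adjacent-not-deleted del′ (subst (DeletedPos _) (position-suc (≤-pred l<v)) del))

  kept-before-end : ∀ {v} → μ₁ v → ¬ μ₂ v → RunEnd p v → ∃ λ u → suc u ≡ v × Kept u
  kept-before-end {v} v∈ ¬d end with left-neighbour? v
  ... | inj₂ start = ⊥-elim (no-isolated v∈ ¬d start end)
  ... | inj₁ (u , refl , u∈) with chainAt u∈ v∈
  ... | chain lh l r rh ch l≤u u<r with m≤n⇒m<n∨m≡n u<r
  ...   | inj₁ v<r =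
    contradiction (run (chain⇒shape ch (≤-<-trans l≤u u<r)) (suc v) (≤-trans l≤u (m≤n+m u 2)) v<r) end
  kept-before-end v∈ ¬d end | inj₁ (u , refl , u∈) | chain lh l .(suc u) true ch l≤u u<r | inj₂ refl =
    contradiction (rightEnd (chain⇒shape ch (≤-<-trans l≤u u<r))) ¬d
  kept-before-end v∈ ¬d end | inj₁ (u , refl , u∈) | chain lh l .(suc u) false ch l≤u u<r | inj₂ refl =
    u , refl , not-deleted⇒kept ch l≤u u<r
      (last-not-deleted ∘ subst (DeletedPos _) (trans (sym (+-identityʳ _)) (position-end false l≤u)))

  kept-neighbour : ∀ {v} → μ₁ v → ¬ μ₂ v → (∃ λ u → suc u ≡ v × Kept u) ⊎ Kept v
  kept-neighbour {v} v∈ ¬d with μ₁? (suc v)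
  ... | yes v+1∈ = kept-in-chain (chainAt v∈ v+1∈) ¬d
  ... | no v+1∉  = inj₁ (kept-before-end v∈ ¬d v+1∉)

  no-three-kept : ∀ {lh l r rh j x₀ y₀ x₁ y₁ x₂ y₂} → IsChain p lh l r rh →
                  ChainEdge lh l r rh j x₀ y₀ → ChainEdge lh l r rh (suc j) x₁ y₁ →
                  ChainEdge lh l r rh (suc (suc j)) x₂ y₂ →
                  Adj' p x₀ y₀ → Adj' p x₁ y₁ → Adj' p x₂ y₂ → ⊥
  no-three-kept {lh} {l} {r} {rh} ch e₀ e₁ e₂ a₀ a₁ a₂ =
    [ kept e₀ a₀ , [ kept e₁ a₁ , kept e₂ a₂ ]′ ]′
      (deleted-in-window (admissible _ _ _ _ ch) (proj₁ (chainEdge-bounds e₀)) (proj₂ (chainEdge-bounds e₂)))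
    where
    kept : ∀ {j x y} → ChainEdge lh l r rh j x y → Adj' p x y → ¬ DeletedPos (chainLength lh l r rh) j
    kept = adjacent⇒not-deleted ch

  start-below : ∀ {lh l r rh v} → IsChain p lh l r rh → l ≤ suc v → suc v < r →
                μ₁ v → ¬ μ₂ (suc v) → l ≤ v
  start-below ch l≤1+v 1+v<r v∈ ¬d with m≤n⇒m<n∨m≡n l≤1+v
  ... | inj₁ l<1+v = ≤-pred l<1+v
  start-below {true}  ch _ 1+v<r _  ¬d | inj₂ refl = contradiction (leftEnd (chain⇒shape ch 1+v<r)) ¬d
  start-below {false} ch _ 1+v<r v∈ _  | inj₂ refl = ⊥-elim (proj₂ (leftEnd (chain⇒shape ch 1+v<r)) _ refl v∈)

  end-above : ∀ {lh l r rh w} → IsChain p lh l r rh → l < w → w ≤ r → μ₁ (suc w) → ¬ μ₂ w → w < r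
  end-above ch l<w w≤r w+1∈ ¬d with m≤n⇒m<n∨m≡n w≤r
  ... | inj₁ w<r = w<r
  end-above {rh = true}  ch l<w _ _    ¬d | inj₂ refl = contradiction (rightEnd (chain⇒shape ch l<w)) ¬d
  end-above {rh = false} ch l<w _ w+1∈ _  | inj₂ refl = contradiction w+1∈ (proj₂ (rightEnd (chain⇒shape ch l<w)))

  doubled-start : ∀ {lh l r rh v} → IsChain p lh l r rh → l ≤ v → v < r → μ₂ v → lh ≡ true × l ≡ v
  doubled-start ch l≤v v<r d with m≤n⇒m<n∨m≡n l≤v
  ... | inj₁ l<v = contradiction d (inner (chain⇒shape ch (<-trans l<v v<r)) _ l<v v<r)
  doubled-start {true}  ch _ v<r d | inj₂ refl = refl , refl
  doubled-start {false} ch _ v<r d | inj₂ refl = contradiction d (proj₁ (leftEnd (chain⇒shape ch v<r)))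

  doubled-end : ∀ {lh l r rh v} → IsChain p lh l r rh → l < v → v ≤ r → μ₂ v → rh ≡ true × r ≡ v
  doubled-end ch l<v v≤r d with m≤n⇒m<n∨m≡n v≤r
  ... | inj₁ v<r = contradiction d (inner (chain⇒shape ch (<-trans l<v v<r)) _ l<v v<r)
  doubled-end {rh = true}  ch l<v _ d | inj₂ refl = refl , refl
  doubled-end {rh = false} ch l<v _ d | inj₂ refl = contradiction d (proj₁ (rightEnd (chain⇒shape ch l<v)))

  chainAt-kept : ∀ {v} → Kept v → ChainAt v
  chainAt-kept k = chainAt (proj₁ (kept⇒μ₁ k)) (proj₂ (kept⇒μ₁ k))

  -- v, v+1, v+2, v+3 would be three consecutive kept edges of the chain through v+1.
  no-kept-backbone-path : ∀ {v} → ¬ μ₂ (suc v) → ¬ μ₂ (suc (suc v)) →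
                          Kept v → Kept (suc v) → ¬ Kept (suc (suc v))
  no-kept-backbone-path {v} ¬d₁ ¬d₂ k₀ k₁ k₂ with chainAt-kept k₁
  ... | chain lh l r rh ch l≤1+v 1+v<r =
    no-three-kept ch (backbone-edge l≤v (<-trans (n<1+n v) 1+v<r))
      (reindex (position-suc l≤v) (backbone-edge (≤-trans l≤v (n≤1+n v)) 1+v<r))
      (reindex (trans (position-suc (≤-trans l≤v (n≤1+n v))) (cong suc (position-suc l≤v)))
        (backbone-edge (≤-trans l≤v (≤-trans (n≤1+n v) (n≤1+n (suc v)))) 2+v<r))
      k₀ k₁ k₂
    where
    l≤v = start-below ch l≤1+v 1+v<r (proj₁ (kept⇒μ₁ k₀)) ¬d₁
    2+v<r = end-above ch (s≤s (≤-trans l≤v (n≤1+n v))) 1+v<r (proj₂ (kept⇒μ₁ k₂)) ¬d₂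

  -- v′, v, v+1, v+2 would be the first three edges of a chain, all kept.
  no-doubled-kept-kept : ∀ {v} → μ₂ v → Kept v → ¬ Kept (suc v)
  no-doubled-kept-kept {v} d k₀ k₁ with chainAt-kept k₁
  ... | chain lh l r rh ch l≤1+v 1+v<r
    with start-below ch l≤1+v 1+v<r (μ₂⇒μ₁ d) (no-adjacent-doubles d)
  ... | l≤v with doubled-start ch l≤v (<-trans (n<1+n v) 1+v<r) d
  ... | refl , refl =
    no-three-kept ch (hangL v r rh)
      (reindex (position-start true v) (backbone-edge ≤-refl (<-trans (n<1+n v) 1+v<r)))
      (reindex (trans (position-suc {true} {v} ≤-refl) (cong suc (position-start true v)))
        (backbone-edge (n≤1+n v) 1+v<r))
      (Adj'-sym (hanging-kept d)) k₀ k₁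

  -- v, v+1, v+2, (v+2)′ would be the last three edges of a chain, all kept.
  no-kept-kept-doubled : ∀ {v} → Kept v → Kept (suc v) → ¬ μ₂ (suc (suc v))
  no-kept-kept-doubled {v} k₀ k₁ d with chainAt-kept k₁
  ... | chain lh l r rh ch l≤1+v 1+v<r
    with start-below ch l≤1+v 1+v<r (proj₁ (kept⇒μ₁ k₀)) (λ d₁ → no-adjacent-doubles d₁ d)
  ... | l≤v with doubled-end ch (s≤s (≤-trans l≤v (n≤1+n v))) 1+v<r d
  ... | refl , refl =
    no-three-kept ch (backbone-edge l≤v (<-trans (n<1+n v) 1+v<r))
      (reindex (position-suc l≤v) (backbone-edge l≤1+v 1+v<r))
      (reindex (trans (sym (position-end true l≤1+v)) (trans (+-comm _ 1) (cong suc (position-suc l≤v))))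
        (hangR lh l (suc (suc v))))
      k₀ k₁ (hanging-kept d)

  no-kept-triple : ∀ {v} → Kept v → Kept (suc v) → ¬ Kept (suc (suc v))
  no-kept-triple k₀ k₁ k₂ with μ₂? _ | μ₂? _
  ... | yes d₁ | _      = no-doubled-kept-kept d₁ k₁ k₂
  ... | no _   | yes d₂ = no-kept-kept-doubled k₀ k₁ d₂
  ... | no ¬d₁ | no ¬d₂ = no-kept-backbone-path ¬d₁ ¬d₂ k₀ k₁ k₂

  -- The six component types

  NoKeptLeft : ℕ → Set
  NoKeptLeft l = ∀ u → suc u ≡ l → ¬ Kept u

  module Realization (P : Pattern) (flag : Fin (size P) → Bool) (l : ℕ) where

    vertex : Fin (size P) → Vertex
    vertex i = (offset P i + l , flag i)

    realizes : 1 ≤ l →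
               (decode : ℕ × Bool → Fin (size P)) → (∀ i → decode (offset P i , flag i) ≡ i) →
               (∃ λ i₀ → vertex i₀ ≡ (l , false)) →
               (∀ i → Star (Adj' p) (l , false) (vertex i)) →
               (∀ i {y} → Adj' p (vertex i) y → ∃ λ j → vertex j ≡ y) →
               (∀ i j → Adj' p (vertex i) (vertex j) ⇔ T (edge P i j)) →
               ∀ {x} → Star (Adj' p) (l , false) x → Realizes p x P
    realizes 1≤l decode decode-vertex root reach closed adjacency {x} path =
      l , 1≤l , vertex , injective , component , adjacency , λ i → +-comm (offset P i) l
      where
      injective : Injective _≡_ _≡_ vertex
      injective {i} {j} eq = begin
        i                                ≡⟨ decode-vertex i ⟨
        decode (offset P i , flag i)     ≡⟨ cong decode (cong₂ _,_ (+-cancelʳ-≡ l _ _ (cong proj₁ eq))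
                                                                  (cong proj₂ eq)) ⟩
        decode (offset P j , flag j)     ≡⟨ decode-vertex j ⟩
        j                                ∎
        where open ≡-Reasoning
      stays : ∀ {z y} → (∃ λ i → vertex i ≡ z) → Star (Adj' p) z y → ∃ λ j → vertex j ≡ y
      stays found ε = found
      stays (i , refl) (a ◅ s) = stays (closed i a) s
      component : ∀ y → Star (Adj' p) x y ⇔ (∃ λ i → vertex i ≡ y)
      component y = mk⇔ (λ s → stays root (path ◅◅ s)) λ { (i , refl) → reverse Adj'-sym path ◅◅ reach i }

  edge2-adjacency : (f : Fin 2 → Vertex) → Adj' p (f 0F) (f 1F) → ∀ i j → Adj' p (f i) (f j) ⇔ T (edge2 i j)
  edge2-adjacency f a 0F 0F = empty⇔false Adj'-irrefl
  edge2-adjacency f a 0F 1F = inhabited⇔true a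
  edge2-adjacency f a 1F 0F = inhabited⇔true (Adj'-sym a)
  edge2-adjacency f a 1F 1F = empty⇔false Adj'-irrefl

  path3-adjacency : (f : Fin 3 → Vertex) → Adj' p (f 0F) (f 1F) → Adj' p (f 1F) (f 2F) → ¬ Adj' p (f 0F) (f 2F) →
                    ∀ i j → Adj' p (f i) (f j) ⇔ T (path3 i j)
  path3-adjacency f a₀₁ a₁₂ ¬a₀₂ 0F 0F = empty⇔false Adj'-irrefl
  path3-adjacency f a₀₁ a₁₂ ¬a₀₂ 0F 1F = inhabited⇔true a₀₁
  path3-adjacency f a₀₁ a₁₂ ¬a₀₂ 0F 2F = empty⇔false ¬a₀₂
  path3-adjacency f a₀₁ a₁₂ ¬a₀₂ 1F 0F = inhabited⇔true (Adj'-sym a₀₁)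
  path3-adjacency f a₀₁ a₁₂ ¬a₀₂ 1F 1F = empty⇔false Adj'-irrefl
  path3-adjacency f a₀₁ a₁₂ ¬a₀₂ 1F 2F = inhabited⇔true a₁₂
  path3-adjacency f a₀₁ a₁₂ ¬a₀₂ 2F 0F = empty⇔false (¬a₀₂ ∘ Adj'-sym)
  path3-adjacency f a₀₁ a₁₂ ¬a₀₂ 2F 1F = inhabited⇔true (Adj'-sym a₁₂)
  path3-adjacency f a₀₁ a₁₂ ¬a₀₂ 2F 2F = empty⇔false Adj'-irrefl

  star4-adjacency : (f : Fin 4 → Vertex) → Adj' p (f 1F) (f 0F) → Adj' p (f 1F) (f 2F) → Adj' p (f 1F) (f 3F) →
                    ¬ Adj' p (f 0F) (f 2F) → ¬ Adj' p (f 0F) (f 3F) → ¬ Adj' p (f 2F) (f 3F) →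
                    ∀ i j → Adj' p (f i) (f j) ⇔ T (star4 i j)
  star4-adjacency f a₁₀ a₁₂ a₁₃ ¬a₀₂ ¬a₀₃ ¬a₂₃ = adjacency
    where
    adjacency : ∀ i j → Adj' p (f i) (f j) ⇔ T (star4 i j)
    adjacency 0F 0F = empty⇔false Adj'-irrefl
    adjacency 0F 1F = inhabited⇔true (Adj'-sym a₁₀)
    adjacency 0F 2F = empty⇔false ¬a₀₂
    adjacency 0F 3F = empty⇔false ¬a₀₃
    adjacency 1F 0F = inhabited⇔true a₁₀
    adjacency 1F 1F = empty⇔false Adj'-irrefl
    adjacency 1F 2F = inhabited⇔true a₁₂
    adjacency 1F 3F = inhabited⇔true a₁₃
    adjacency 2F 0F = empty⇔false (¬a₀₂ ∘ Adj'-sym)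
    adjacency 2F 1F = inhabited⇔true (Adj'-sym a₁₂)
    adjacency 2F 2F = empty⇔false Adj'-irrefl
    adjacency 2F 3F = empty⇔false ¬a₂₃
    adjacency 3F 0F = empty⇔false (¬a₀₃ ∘ Adj'-sym)
    adjacency 3F 1F = inhabited⇔true (Adj'-sym a₁₃)
    adjacency 3F 2F = empty⇔false (¬a₂₃ ∘ Adj'-sym)
    adjacency 3F 3F = empty⇔false Adj'-irrefl

  component-AA : ∀ {l} → μ₁ l → NoKeptLeft l → μ₂ l → ¬ Kept l →
                 ∀ {x} → Star (Adj' p) (l , false) x → Realizes p x typeAA
  component-AA {l} l∈ left d ¬k =
    realizes (μ₁-positive l∈) decode (λ { 0F → refl ; 1F → refl }) (0F , refl) reach closed
      (edge2-adjacency vertex (hanging-kept d))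
    where
    flag : Fin 2 → Bool
    flag 0F = false
    flag 1F = true
    open Realization typeAA flag l
    decode : ℕ × Bool → Fin 2
    decode (_ , false) = 0F
    decode (_ , true)  = 1F
    reach : ∀ i → Star (Adj' p) (l , false) (vertex i)
    reach 0F = ε
    reach 1F = return (hanging-kept d)
    closed : ∀ i {y} → Adj' p (vertex i) y → ∃ λ j → vertex j ≡ y
    closed 0F a with neighbour a
    ... | next k     = contradiction k ¬k
    ... | twin _     = 1F , refl
    ... | prev eq k  = contradiction k (left _ eq)
    closed 1F a with twin-neighbour a
    ... | refl = 0F , refl

  component-AB : ∀ {l} → μ₁ l → NoKeptLeft l → ¬ μ₂ l → ¬ μ₂ (suc l) → Kept l → ¬ Kept (suc l) →
                 ∀ {x} → Star (Adj' p) (l , false) x → Realizes p x typeAB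
  component-AB {l} l∈ left ¬d₀ ¬d₁ k₀ ¬k₁ =
    realizes (μ₁-positive l∈) decode (λ { 0F → refl ; 1F → refl }) (0F , refl) reach closed
      (edge2-adjacency vertex k₀)
    where
    open Realization typeAB (λ _ → false) l
    decode : ℕ × Bool → Fin 2
    decode (0 , _) = 0F
    decode (_ , _) = 1F
    reach : ∀ i → Star (Adj' p) (l , false) (vertex i)
    reach 0F = ε
    reach 1F = return k₀
    closed : ∀ i {y} → Adj' p (vertex i) y → ∃ λ j → vertex j ≡ y
    closed 0F a with neighbour a
    ... | next _     = 1F , refl
    ... | twin d₀    = contradiction d₀ ¬d₀
    ... | prev eq k  = contradiction k (left _ eq)
    closed 1F a with neighbour a
    ... | next k₁    = contradiction k₁ ¬k₁
    ... | twin d₁    = contradiction d₁ ¬d₁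
    ... | prev refl _ = 0F , refl

  component-AAB : ∀ {l} → μ₁ l → NoKeptLeft l → μ₂ l → ¬ μ₂ (suc l) → Kept l → ¬ Kept (suc l) →
                  ∀ {x} → Star (Adj' p) (l , false) x → Realizes p x typeAAB
  component-AAB {l} l∈ left d₀ ¬d₁ k₀ ¬k₁ =
    realizes (μ₁-positive l∈) decode (λ { 0F → refl ; 1F → refl ; 2F → refl }) (1F , refl) reach closed
      (path3-adjacency vertex (Adj'-sym (hanging-kept d₀)) k₀ ¬Adj'-twin-next)
    where
    flag : Fin 3 → Bool
    flag 0F = true
    flag _  = false
    open Realization typeAAB flag l
    decode : ℕ × Bool → Fin 3
    decode (0 , true)  = 0F
    decode (0 , false) = 1F
    decode (_ , _)     = 2F
    reach : ∀ i → Star (Adj' p) (l , false) (vertex i)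
    reach 0F = return (hanging-kept d₀)
    reach 1F = ε
    reach 2F = return k₀
    closed : ∀ i {y} → Adj' p (vertex i) y → ∃ λ j → vertex j ≡ y
    closed 0F a with twin-neighbour a
    ... | refl = 1F , refl
    closed 1F a with neighbour a
    ... | next _     = 2F , refl
    ... | twin _     = 0F , refl
    ... | prev eq k  = contradiction k (left _ eq)
    closed 2F a with neighbour a
    ... | next k₁    = contradiction k₁ ¬k₁
    ... | twin d₁    = contradiction d₁ ¬d₁
    ... | prev refl _ = 1F , refl

  component-ABB : ∀ {l} → μ₁ l → NoKeptLeft l → ¬ μ₂ l → μ₂ (suc l) → Kept l → ¬ Kept (suc l) →
                  ∀ {x} → Star (Adj' p) (l , false) x → Realizes p x typeABB
  component-ABB {l} l∈ left ¬d₀ d₁ k₀ ¬k₁ =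
    realizes (μ₁-positive l∈) decode (λ { 0F → refl ; 1F → refl ; 2F → refl }) (0F , refl) reach closed
      (path3-adjacency vertex k₀ (hanging-kept d₁) ¬Adj'-next-twin)
    where
    flag : Fin 3 → Bool
    flag 2F = true
    flag _  = false
    open Realization typeABB flag l
    decode : ℕ × Bool → Fin 3
    decode (0 , _)     = 0F
    decode (_ , false) = 1F
    decode (_ , true)  = 2F
    reach : ∀ i → Star (Adj' p) (l , false) (vertex i)
    reach 0F = ε
    reach 1F = return k₀
    reach 2F = k₀ ◅ return (hanging-kept d₁)
    closed : ∀ i {y} → Adj' p (vertex i) y → ∃ λ j → vertex j ≡ y
    closed 0F a with neighbour a
    ... | next _     = 1F , refl
    ... | twin d₀    = contradiction d₀ ¬d₀
    ... | prev eq k  = contradiction k (left _ eq)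
    closed 1F a with neighbour a
    ... | next k₁    = contradiction k₁ ¬k₁
    ... | twin _     = 2F , refl
    ... | prev refl _ = 0F , refl
    closed 2F a with twin-neighbour a
    ... | refl = 1F , refl

  component-ABC : ∀ {l} → μ₁ l → NoKeptLeft l → ¬ μ₂ l → ¬ μ₂ (suc l) → ¬ μ₂ (suc (suc l)) →
                  Kept l → Kept (suc l) → ¬ Kept (suc (suc l)) →
                  ∀ {x} → Star (Adj' p) (l , false) x → Realizes p x typeABC
  component-ABC {l} l∈ left ¬d₀ ¬d₁ ¬d₂ k₀ k₁ ¬k₂ =
    realizes (μ₁-positive l∈) decode (λ { 0F → refl ; 1F → refl ; 2F → refl }) (0F , refl) reach closed
      (path3-adjacency vertex k₀ k₁ ¬Adj'-skip)
    where
    open Realization typeABC (λ _ → false) l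
    decode : ℕ × Bool → Fin 3
    decode (0 , _) = 0F
    decode (1 , _) = 1F
    decode (_ , _) = 2F
    reach : ∀ i → Star (Adj' p) (l , false) (vertex i)
    reach 0F = ε
    reach 1F = return k₀
    reach 2F = k₀ ◅ return k₁
    closed : ∀ i {y} → Adj' p (vertex i) y → ∃ λ j → vertex j ≡ y
    closed 0F a with neighbour a
    ... | next _     = 1F , refl
    ... | twin d₀    = contradiction d₀ ¬d₀
    ... | prev eq k  = contradiction k (left _ eq)
    closed 1F a with neighbour a
    ... | next _     = 2F , refl
    ... | twin d₁    = contradiction d₁ ¬d₁
    ... | prev refl _ = 0F , refl
    closed 2F a with neighbour a
    ... | next k₂    = contradiction k₂ ¬k₂
    ... | twin d₂    = contradiction d₂ ¬d₂
    ... | prev refl _ = 1F , refl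

  component-ABBC : ∀ {l} → μ₁ l → NoKeptLeft l → ¬ μ₂ l → μ₂ (suc l) → ¬ μ₂ (suc (suc l)) →
                   Kept l → Kept (suc l) → ¬ Kept (suc (suc l)) →
                   ∀ {x} → Star (Adj' p) (l , false) x → Realizes p x typeABBC
  component-ABBC {l} l∈ left ¬d₀ d₁ ¬d₂ k₀ k₁ ¬k₂ =
    realizes (μ₁-positive l∈) decode (λ { 0F → refl ; 1F → refl ; 2F → refl ; 3F → refl }) (0F , refl)
      reach closed
      (star4-adjacency vertex (Adj'-sym k₀) (hanging-kept d₁) k₁ ¬Adj'-next-twin ¬Adj'-skip ¬Adj'-twin-next)
    where
    flag : Fin 4 → Bool
    flag 2F = true
    flag _  = false
    open Realization typeABBC flag l
    decode : ℕ × Bool → Fin 4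
    decode (0 , _)     = 0F
    decode (1 , false) = 1F
    decode (1 , true)  = 2F
    decode (_ , _)     = 3F
    reach : ∀ i → Star (Adj' p) (l , false) (vertex i)
    reach 0F = ε
    reach 1F = return k₀
    reach 2F = k₀ ◅ return (hanging-kept d₁)
    reach 3F = k₀ ◅ return k₁
    closed : ∀ i {y} → Adj' p (vertex i) y → ∃ λ j → vertex j ≡ y
    closed 0F a with neighbour a
    ... | next _     = 1F , refl
    ... | twin d₀    = contradiction d₀ ¬d₀
    ... | prev eq k  = contradiction k (left _ eq)
    closed 1F a with neighbour a
    ... | next _     = 3F , refl
    ... | twin _     = 2F , refl
    ... | prev refl _ = 0F , refl
    closed 2F a with twin-neighbour a
    ... | refl = 1F , refl
    closed 3F a with neighbour a
    ... | next k₂    = contradiction k₂ ¬k₂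
    ... | twin d₂    = contradiction d₂ ¬d₂
    ... | prev refl _ = 1F , refl

  component-from-start : ∀ {l} → μ₁ l → NoKeptLeft l → ∀ {x} → Star (Adj' p) (l , false) x → OfSixTypes p x
  component-from-start {l} l∈ left with kept? l
  ... | no ¬k₀ with μ₂? l
  ...   | yes d₀ = inj₁ ∘ component-AA l∈ left d₀ ¬k₀
  ...   | no ¬d₀ = ⊥-elim ([ (λ (u , eq , k) → left u eq k) , ¬k₀ ]′ (kept-neighbour l∈ ¬d₀))
  component-from-start {l} l∈ left | yes k₀ with kept? (suc l) | μ₂? l | μ₂? (suc l)
  ... | no ¬k₁ | yes d₀ | yes d₁ = ⊥-elim (no-adjacent-doubles d₀ d₁)
  ... | no ¬k₁ | no ¬d₀ | no ¬d₁ = inj₂ ∘ inj₁ ∘ component-AB l∈ left ¬d₀ ¬d₁ k₀ ¬k₁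
  ... | no ¬k₁ | yes d₀ | no ¬d₁ = inj₂ ∘ inj₂ ∘ inj₁ ∘ component-AAB l∈ left d₀ ¬d₁ k₀ ¬k₁
  ... | no ¬k₁ | no ¬d₀ | yes d₁ = inj₂ ∘ inj₂ ∘ inj₂ ∘ inj₁ ∘ component-ABB l∈ left ¬d₀ d₁ k₀ ¬k₁
  ... | yes k₁ | _ | no ¬d₁ =
    inj₂ ∘ inj₂ ∘ inj₂ ∘ inj₂ ∘ inj₁ ∘
      component-ABC l∈ left (λ d₀ → no-doubled-kept-kept d₀ k₀ k₁) ¬d₁ (no-kept-kept-doubled k₀ k₁)
        k₀ k₁ (no-kept-triple k₀ k₁)
  ... | yes k₁ | _ | yes d₁ =
    inj₂ ∘ inj₂ ∘ inj₂ ∘ inj₂ ∘ inj₂ ∘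
      component-ABBC l∈ left (λ d₀ → no-doubled-kept-kept d₀ k₀ k₁) d₁ (no-kept-kept-doubled k₀ k₁)
        k₀ k₁ (no-kept-triple k₀ k₁)

  leftmost : ∀ v → μ₁ v → ∃ λ l → μ₁ l × NoKeptLeft l × Star (Adj' p) (l , false) (v , false)
  leftmost zero v∈ = zero , v∈ , (λ _ ()) , ε
  leftmost (suc u) v∈ with kept? u
  ... | no ¬k = suc u , v∈ , (λ { _ refl → ¬k }) , ε
  ... | yes k with leftmost u (proj₁ (kept⇒μ₁ k))
  ...   | l , l∈ , left , path = l , l∈ , left , path ◅◅ return k

  component-type : ∀ x → IsVertex p x → OfSixTypes p x
  component-type (v , false) v∈ with leftmost v v∈
  ... | l , l∈ , left , path = component-from-start l∈ left path
  component-type (v , true) d with leftmost v (μ₂⇒μ₁ d)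
  ... | l , l∈ , left , path = component-from-start l∈ left (path ◅◅ return (hanging-kept d))

proposition5p4 : (p : List ℕ) → IsPartition p → Neighborly p → Admissible p →
    (x : Vertex) → IsVertex p x → OfSixTypes p x
proposition5p4 p (positive , _) _ admissible = Components.component-type p positive admissible
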